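{- Let $G=(V,E)$ be a connected, undirected, unweighted graph with $|V|=n$. Let $s=\omega(\log n)$ be an integer parameter, and let $S$ be a sample of $s$ vertices selected uniformly and independently at random from $V$; let $\hat E$ be the set of pairs $\{a,b\}\subseteq V$, $a\ne b$, such that $D(a,b)\cap S=\emptyset$. Let $B$ be the set of vertex pairs $\{a,b\}\subseteq V$ such that $\delta(a,b)\ge 2$ and $|D(a,b)|\le 3n\cdot(\log n)/s$. Then $\mathbb{E}_S[|\hat E\setminus E|]\le |B|+o(1)$.
   Context: $\delta(a,b)$ denotes the shortest-path distance. For distinct vertices $a,b$, a vertex $u\in V$ distinguishes $a$ and $b$ if $|\delta(u,a)-\delta(u,b)|>1$; $D(a,b)\subseteq V$ is the set of vertices distinguishing $a$ and $b$. Thus $\hat E$ is exactly the set of pairs $\{a,b\}$ with $|\delta(u,a)-\delta(u,b)|\le1$ for all $u\in S$. Asymptotics are as $n\to\infty$. -}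

module Defs where

open import Data.Nat using (ℕ; zero; suc; _+_; _*_; _^_; _≤_; _<_; ∣_-_∣)
open import Data.Nat using (_!)
open import Data.Nat.ListAction using (sum)
open import Data.Bool using (Bool; true; false; _∧_; _∨_; not; if_then_else_)
open import Data.Fin using (Fin; toℕ)
open import Data.Fin.Properties using (_≟_)
open import Data.List using (List; []; _∷_; [_]; map; concatMap; length; filter; allFin; upTo)
open import Data.Vec using (Vec; []; _∷_)
open import Data.Vec.Membership.Propositional as VM using ()
open import Data.Product using (Σ; ∃; _×_)
open import Relation.Binary.PropositionalEquality using (_≡_)
open import Relation.Nullary.Decidable using (⌊_⌋)
open import Data.Nat using (_≤ᵇ_; _<ᵇ_)

record Graph (n : ℕ) : Set where
  field
    adj   : Fin n → Fin n → Bool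
    sym   : ∀ a b → adj a b ≡ adj b a
    irrefl : ∀ a → adj a a ≡ false
open Graph public

anyV : ∀ {n} → (Fin n → Bool) → Bool
anyV {n} p = Data.List.foldr _∨_ false (map p (allFin n))

countV : ∀ {n} → (Fin n → Bool) → ℕ
countV {n} p = length (filter (λ x → p x Data.Bool.≟ true) (allFin n))

reach : ∀ {n} → Graph n → ℕ → Fin n → Fin n → Bool
reach G zero    a b = ⌊ a ≟ b ⌋
reach G (suc k) a b = reach G k a b ∨ anyV (λ c → reach G k a c ∧ adj G c b)

Connected : ∀ {n} → Graph n → Set
Connected G = ∀ a b → ∃ λ k → reach G k a b ≡ true

-- shortest-path distance δ(a,b): the least k with a walk of length ≤ k,
-- computed as the number of k < n with no such walk (reach is monotone in k,
-- and in a connected graph on n vertices δ(a,b) ≤ n - 1).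
δ : ∀ {n} → Graph n → Fin n → Fin n → ℕ
δ {n} G a b = length (filter (λ k → not (reach G k a b) Data.Bool.≟ true) (upTo n))

distinguishes : ∀ {n} → Graph n → Fin n → Fin n → Fin n → Bool
distinguishes G u a b = 1 <ᵇ ∣ δ G u a - δ G u b ∣

Dsize : ∀ {n} → Graph n → Fin n → Fin n → ℕ
Dsize G a b = countV (λ u → distinguishes G u a b)

avoids : ∀ {n s} → Graph n → Vec (Fin n) s → Fin n → Fin n → Bool
avoids G []      a b = true
avoids G (u ∷ S) a b = not (distinguishes G u a b) ∧ avoids G S a b

-- number of unordered pairs {a,b}, a ≠ b (counted as toℕ a < toℕ b) satisfying p
countPairs : ∀ {n} → (Fin n → Fin n → Bool) → ℕ
countPairs p = sum (map (λ a → countV (λ b → (toℕ a <ᵇ toℕ b) ∧ p a b)) (allFin _))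

hatEminusE : ∀ {n s} → Graph n → Vec (Fin n) s → ℕ
hatEminusE G S = countPairs (λ a b → avoids G S a b ∧ not (adj G a b))

-- all s-tuples of vertices (the n^s equally likely outcomes of sampling s
-- vertices uniformly and independently)
allSamples : (n s : ℕ) → List (Vec (Fin n) s)
allSamples n zero    = [ [] ]
allSamples n (suc s) = concatMap (λ i → map (i ∷_) (allSamples n s)) (allFin n)

-- n^s · E_S[ |Ê \ E| ]
totalHatEminusE : ∀ {n} → Graph n → (s : ℕ) → ℕ
totalHatEminusE {n} G s = sum (map (hatEminusE G) (allSamples n s))

-- expTimesFact k j = j! · Σ_{i ≤ j} k^i / i!   (a natural number)
expTimesFact : ℕ → ℕ → ℕ
expTimesFact k zero    = 1
expTimesFact k (suc j) = suc j * expTimesFact k j + k ^ suc j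

-- e^k ≤ m  (e = Euler's number): every partial sum of the exponential series
-- Σ_{i ≤ j} k^i/i! (which increase to e^k) is ≤ m.
ExpLe : ℕ → ℕ → Set
ExpLe k m = ∀ j → expTimesFact k j ≤ m * (j !)

-- |B|: unordered pairs {a,b} with δ(a,b) ≥ 2 and |D(a,b)| ≤ 3 n ln n / s,
-- the last condition written as  e^(|D(a,b)| · s) ≤ n^(3n).
-- ExpLe is not given as a Bool, so the statement quantifies over any Boolean
-- characteristic function of B (which is unique) and counts it with countPairs.
InB : ∀ {n} → Graph n → ℕ → Fin n → Fin n → Set
InB {n} G s a b = 2 ≤ δ G a b × ExpLe (Dsize G a b * s) (n ^ (3 * n))

-- s = ω(log n):  for every M, eventually s(n) ≥ M log₂ n, i.e. n^M ≤ 2^s(n)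
OmegaLog : (ℕ → ℕ) → Set
OmegaLog s = ∀ M → ∃ λ N → ∀ n → N ≤ n → n ^ M ≤ 2 ^ s n

IsCharB : ∀ {n} → Graph n → ℕ → (Fin n → Fin n → Bool) → Set
IsCharB G s χ = ∀ a b → (χ a b ≡ true → InB G s a b) × (InB G s a b → χ a b ≡ true)

{-# OPTIONS --safe #-}
-- For a pair {a, b} with c = n − |D(a,b)| non-distinguishing vertices, exactly c^s of the n^s
-- samples avoid D(a,b), so n^s · E|Ê ∖ E| is the sum of c^s over the non-adjacent pairs.
-- A pair of B contributes at most n^s. Any other pair has |D| s > 3 n ln n, hence
-- (c/n)^s ≤ e^(−|D| s / n) < n^(−3) ≤ 1/((k+1) n²) once (k+1)^4 ≤ n, and the at most n² such
-- pairs contribute less than n^s/(k+1) together. The estimates involving e use the rational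
-- stand-ins (1 − d/n)^n ≤ (2/5)^d and e ≤ 27/8; the latter comes from the convexity of the
-- partial sums of the exponential series.
module Submission where

open import Data.Bool using (Bool; true; false; _∧_; not)
import Data.Bool as Bool
open import Data.Bool.ListAction using (or)
open import Data.Bool.Properties using (T-≡)
open import Data.Fin using (Fin; toℕ; zero)
open import Data.Fin.Properties using (_≟_)
open import Data.List using (List; []; _∷_; map; filter; length; allFin; concatMap; _++_)
open import Data.List.Properties using (map-cong; map-∘; map-++; length-tabulate)
open import Data.Nat using (ℕ; zero; suc; _+_; _*_; _^_; _!; _<ᵇ_; _≤_; _≤?_; z≤n; s≤s; NonZero; >-nonZero)
open import Data.Nat.ListAction using (sum)
open import Data.Nat.ListAction.Properties using (sum-++)
open import Data.Nat.Properties hiding (_≟_)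
open import Algebra.Properties.CommutativeSemigroup *-commutativeSemigroup
  using (x∙yz≈y∙xz; xy∙z≈y∙xz; xy∙z≈xz∙y; x∙yz≈xz∙y)
open import Algebra.Properties.CommutativeSemigroup +-commutativeSemigroup
  using () renaming (x∙yz≈y∙xz to x∙yz≈y∙xz⁺)
open import Data.Nat.Tactic.RingSolver using (solve-∀)
open import Data.Product using (∃; _,_; proj₂)
open import Data.Vec using (Vec; _∷_)
open import Defs hiding (sym)
open import Function using (_∘_; id)
open import Function.Bundles using (Equivalence)
open import Relation.Binary.PropositionalEquality
  using (_≡_; _≢_; refl; sym; trans; cong; cong₂; subst; subst₂)
open import Relation.Nullary.Decidable using (yes; no; from-yes; dec-false; isYes≗does)
open import Relation.Nullary.Negation using (¬_; contradiction)

open ≤-Reasoning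

^-distribʳ-* : ∀ m n o → (m * n) ^ o ≡ m ^ o * n ^ o
^-distribʳ-* m n zero    = refl
^-distribʳ-* m n (suc o) = begin-equality
  m * n * (m * n) ^ o       ≡⟨ cong (m * n *_) (^-distribʳ-* m n o) ⟩
  m * n * (m ^ o * n ^ o)   ≡⟨ [m*n]*[o*p]≡[m*o]*[n*p] m n (m ^ o) (n ^ o) ⟩
  m * m ^ o * (n * n ^ o)   ∎

^-swapʳ : ∀ m n o → (m ^ n) ^ o ≡ (m ^ o) ^ n
^-swapʳ m n o = begin-equality
  (m ^ n) ^ o   ≡⟨ ^-*-assoc m n o ⟩
  m ^ (n * o)   ≡⟨ cong (m ^_) (*-comm n o) ⟩
  m ^ (o * n)   ≡⟨ ^-*-assoc m o n ⟨
  (m ^ o) ^ n   ∎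

^-cancelʳ-≤ : ∀ o .{{_ : NonZero o}} {m n} → m ^ o ≤ n ^ o → m ≤ n
^-cancelʳ-≤ o {m} {n} mᵒ≤nᵒ with m ≤? n
... | yes m≤n = m≤n
... | no  m≰n = contradiction mᵒ≤nᵒ (<⇒≱ (^-monoˡ-< o (≰⇒> m≰n)))

[1+p]^[1+j]≤p^[1+j]+[1+j]*[1+p]^j : ∀ p j → suc p ^ suc j ≤ p ^ suc j + suc j * suc p ^ j
[1+p]^[1+j]≤p^[1+j]+[1+j]*[1+p]^j p zero = ≤-reflexive (base p)
  where
  base : ∀ p → suc p * 1 ≡ p * 1 + 1 * 1
  base = solve-∀
[1+p]^[1+j]≤p^[1+j]+[1+j]*[1+p]^j p (suc j) = begin
  suc p * suc p ^ suc j                          ≤⟨ *-monoʳ-≤ (suc p) ([1+p]^[1+j]≤p^[1+j]+[1+j]*[1+p]^j p j) ⟩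
  suc p * (p ^ suc j + suc j * suc p ^ j)        ≡⟨ expand p (p ^ suc j) (suc p ^ j) j ⟩
  p * p ^ suc j + (p ^ suc j + suc j * suc p ^ suc j)
    ≤⟨ +-monoʳ-≤ (p ^ suc (suc j)) (+-monoˡ-≤ _ (^-monoˡ-≤ (suc j) (n≤1+n p))) ⟩
  p * p ^ suc j + (suc p ^ suc j + suc j * suc p ^ suc j) ∎
  where
  expand : ∀ p x y j → suc p * (x + suc j * y) ≡ p * x + (x + suc j * (suc p * y))
  expand = solve-∀

-- j! q^j Σ_{i ≤ j} (p/q)^i / i!, a scaled partial sum of the series of e^(p/q).
expSumScaled : ℕ → ℕ → ℕ → ℕ
expSumScaled q p zero    = 1
expSumScaled q p (suc j) = suc j * q * expSumScaled q p j + p ^ suc j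

-- With f(x) = Σ_{i ≤ j} x^i/i! and h = 1/q this is f(x+h) − f(x) ≤ h f′(x+h), by convexity of f.
expSumScaled-meanValue : ∀ q p j →
  q * expSumScaled q (suc p) j + suc p ^ j ≤ q * expSumScaled q p j + expSumScaled q (suc p) j
expSumScaled-meanValue q p zero = ≤-refl
expSumScaled-meanValue q p (suc j) = begin
  q * (c * F₊ + suc p ^ suc j) + suc p ^ suc j
    ≡⟨ regroup₁ q c F₊ (suc p ^ suc j) ⟩
  c * (q * F₊) + q * suc p ^ suc j + suc p ^ suc j
    ≤⟨ +-monoˡ-≤ _ (+-monoʳ-≤ (c * (q * F₊)) (*-monoʳ-≤ q ([1+p]^[1+j]≤p^[1+j]+[1+j]*[1+p]^j p j))) ⟩
  c * (q * F₊) + q * (p ^ suc j + suc j * suc p ^ j) + suc p ^ suc j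
    ≡⟨ regroup₂ q F₊ (p ^ suc j) (suc p ^ j) j (suc p ^ suc j) ⟩
  c * (q * F₊ + suc p ^ j) + q * p ^ suc j + suc p ^ suc j
    ≤⟨ +-monoˡ-≤ _ (+-monoˡ-≤ _ (*-monoʳ-≤ c (expSumScaled-meanValue q p j))) ⟩
  c * (q * F + F₊) + q * p ^ suc j + suc p ^ suc j
    ≡⟨ regroup₃ q c F₊ F (p ^ suc j) (suc p ^ suc j) ⟩
  q * (c * F + p ^ suc j) + (c * F₊ + suc p ^ suc j) ∎
  where
  c F F₊ : ℕ
  c  = suc j * q
  F  = expSumScaled q p j
  F₊ = expSumScaled q (suc p) j
  regroup₁ : ∀ q c A Z → q * (c * A + Z) + Z ≡ c * (q * A) + q * Z + Z
  regroup₁ = solve-∀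
  regroup₂ : ∀ q A P Z j W →
    suc j * q * (q * A) + q * (P + suc j * Z) + W ≡ suc j * q * (q * A + Z) + q * P + W
  regroup₂ = solve-∀
  regroup₃ : ∀ q c A B P W → c * (q * B + A) + q * P + W ≡ q * (c * B + P) + (c * A + W)
  regroup₃ = solve-∀

expSumScaled-suc-≤ : ∀ r p j → r * expSumScaled (suc r) (suc p) j ≤ suc r * expSumScaled (suc r) p j
expSumScaled-suc-≤ r p j = +-cancelʳ-≤ F₊ (r * F₊) (suc r * expSumScaled (suc r) p j) (begin
  r * F₊ + F₊                                ≡⟨ +-comm (r * F₊) F₊ ⟩
  suc r * F₊                                 ≤⟨ m≤m+n (suc r * F₊) _ ⟩
  suc r * F₊ + suc p ^ j                     ≤⟨ expSumScaled-meanValue (suc r) p j ⟩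
  suc r * expSumScaled (suc r) p j + F₊      ∎)
  where F₊ = expSumScaled (suc r) (suc p) j

expSumScaled-≤-zero : ∀ r p j → r ^ p * expSumScaled (suc r) p j ≤ suc r ^ p * expSumScaled (suc r) 0 j
expSumScaled-≤-zero r zero    j = ≤-refl
expSumScaled-≤-zero r (suc p) j = begin
  r * r ^ p * expSumScaled (suc r) (suc p) j          ≡⟨ xy∙z≈y∙xz r (r ^ p) _ ⟩
  r ^ p * (r * expSumScaled (suc r) (suc p) j)        ≤⟨ *-monoʳ-≤ (r ^ p) (expSumScaled-suc-≤ r p j) ⟩
  r ^ p * (suc r * expSumScaled (suc r) p j)          ≡⟨ x∙yz≈y∙xz (suc r) (r ^ p) _ ⟨
  suc r * (r ^ p * expSumScaled (suc r) p j)          ≤⟨ *-monoʳ-≤ (suc r) (expSumScaled-≤-zero r p j) ⟩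
  suc r * (suc r ^ p * expSumScaled (suc r) 0 j)      ≡⟨ *-assoc (suc r) (suc r ^ p) _ ⟨
  suc r * suc r ^ p * expSumScaled (suc r) 0 j        ∎

expSumScaled-zero : ∀ q j → expSumScaled q 0 j ≡ q ^ j * j !
expSumScaled-zero q zero    = refl
expSumScaled-zero q (suc j) = begin-equality
  suc j * q * expSumScaled q 0 j + 0     ≡⟨ cong (λ x → suc j * q * x + 0) (expSumScaled-zero q j) ⟩
  suc j * q * (q ^ j * j !) + 0          ≡⟨ regroup j q (q ^ j) (j !) ⟩
  q * q ^ j * (j ! + j * j !)            ∎
  where
  regroup : ∀ j q x y → suc j * q * (x * y) + 0 ≡ q * x * (y + j * y)
  regroup = solve-∀

expSumScaled-* : ∀ q K j → expSumScaled q (q * K) j ≡ q ^ j * expTimesFact K j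
expSumScaled-* q K zero    = refl
expSumScaled-* q K (suc j) = begin-equality
  suc j * q * expSumScaled q (q * K) j + (q * K) ^ suc j
    ≡⟨ cong₂ (λ x y → suc j * q * x + y) (expSumScaled-* q K j) (^-distribʳ-* q K (suc j)) ⟩
  suc j * q * (q ^ j * expTimesFact K j) + q * q ^ j * K ^ suc j
    ≡⟨ regroup j q (q ^ j) (expTimesFact K j) (K ^ suc j) ⟩
  q * q ^ j * (suc j * expTimesFact K j + K ^ suc j) ∎
  where
  regroup : ∀ j q x E y → suc j * q * (x * E) + q * x * y ≡ q * x * (suc j * E + y)
  regroup = solve-∀

-- e ≤ (1 + 1/r)^(r+1): a step of 1/(r+1) multiplies the partial sums by at most 1 + 1/r.
expTimesFact-≤ : ∀ r K j → (r ^ suc r) ^ K * expTimesFact K j ≤ (suc r ^ suc r) ^ K * j !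
expTimesFact-≤ r K j = *-cancelˡ-≤ (q ^ j) {{m^n≢0 q j}} (begin
  q ^ j * ((r ^ q) ^ K * E)                ≡⟨ x∙yz≈y∙xz (q ^ j) ((r ^ q) ^ K) E ⟩
  (r ^ q) ^ K * (q ^ j * E)                ≡⟨ cong₂ _*_ (^-*-assoc r q K) (sym (expSumScaled-* q K j)) ⟩
  r ^ (q * K) * expSumScaled q (q * K) j   ≤⟨ expSumScaled-≤-zero r (q * K) j ⟩
  q ^ (q * K) * expSumScaled q 0 j         ≡⟨ cong₂ _*_ (sym (^-*-assoc q q K)) (expSumScaled-zero q j) ⟩
  (q ^ q) ^ K * (q ^ j * j !)              ≡⟨ x∙yz≈y∙xz ((q ^ q) ^ K) (q ^ j) (j !) ⟩
  q ^ j * ((q ^ q) ^ K * j !)              ∎)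
  where
  q E : ℕ
  q = suc r
  E = expTimesFact K j

ExpLe-intro : ∀ r K M .{{_ : NonZero r}} → (suc r ^ suc r) ^ K ≤ M * (r ^ suc r) ^ K → ExpLe K M
ExpLe-intro r K M ≤M j = *-cancelˡ-≤ ((r ^ suc r) ^ K) {{m^n≢0 (r ^ suc r) K {{m^n≢0 r (suc r)}}}} (begin
  (r ^ suc r) ^ K * expTimesFact K j      ≤⟨ expTimesFact-≤ r K j ⟩
  (suc r ^ suc r) ^ K * j !               ≤⟨ *-monoˡ-≤ (j !) ≤M ⟩
  M * (r ^ suc r) ^ K * j !               ≡⟨ xy∙z≈y∙xz M ((r ^ suc r) ^ K) (j !) ⟩
  (r ^ suc r) ^ K * (M * j !)             ∎)

binomial-three-terms-≤ : ∀ a m →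
  a ^ suc m * (2 * (a * a) + 2 * suc m * a + suc m * m) ≤ 2 * (a * a) * suc a ^ suc m
binomial-three-terms-≤ a zero = ≤-reflexive (base a)
  where
  base : ∀ a → a * 1 * (2 * (a * a) + 2 * 1 * a + 1 * 0) ≡ 2 * (a * a) * (suc a * 1)
  base = solve-∀
binomial-three-terms-≤ a (suc m) = begin
  a * x * T₊                           ≤⟨ m≤m+n (a * x * T₊) (x * suc m * m) ⟩
  a * x * T₊ + x * suc m * m           ≡⟨ expand a x m ⟩
  suc a * (x * T)                      ≤⟨ *-monoʳ-≤ (suc a) (binomial-three-terms-≤ a m) ⟩
  suc a * (2 * (a * a) * suc a ^ suc m) ≡⟨ x∙yz≈y∙xz (suc a) (2 * (a * a)) _ ⟩
  2 * (a * a) * suc a ^ suc (suc m)    ∎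
  where
  x T T₊ : ℕ
  x  = a ^ suc m
  T  = 2 * (a * a) + 2 * suc m * a + suc m * m
  T₊ = 2 * (a * a) + 2 * suc (suc m) * a + suc (suc m) * suc m
  expand : ∀ a x m →
    a * x * (2 * (a * a) + 2 * suc (suc m) * a + suc (suc m) * suc m) + x * suc m * m
      ≡ suc a * (x * (2 * (a * a) + 2 * suc m * a + suc m * m))
  expand = solve-∀

5*a^n≤2*[1+a]^n : ∀ a n → suc a ≤ n → 5 * a ^ n ≤ 2 * suc a ^ n
5*a^n≤2*[1+a]^n zero          (suc m) _             = z≤n
5*a^n≤2*[1+a]^n a@(suc _) n@(suc m) (s≤s a≤m) = *-cancelʳ-≤ (5 * a ^ n) (2 * suc a ^ n) (a * a) (begin
  5 * a ^ n * (a * a)                                      ≡⟨ split (a ^ n) (a * a) ⟩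
  a ^ n * (2 * (a * a) + 3 * (a * a))                      ≤⟨ *-monoʳ-≤ (a ^ n) (+-monoʳ-≤ (2 * (a * a)) quadratic) ⟩
  a ^ n * (2 * (a * a) + (2 * n * a + n * m))              ≡⟨ cong (a ^ n *_) (+-assoc (2 * (a * a)) _ _) ⟨
  a ^ n * (2 * (a * a) + 2 * n * a + n * m)                ≤⟨ binomial-three-terms-≤ a m ⟩
  2 * (a * a) * suc a ^ n                                  ≡⟨ xy∙z≈y∙xz 2 (a * a) _ ⟩
  a * a * (2 * suc a ^ n)                                  ≡⟨ *-comm (a * a) _ ⟩
  2 * suc a ^ n * (a * a)                                  ∎)
  where
  split : ∀ x y → 5 * x * y ≡ x * (2 * y + 3 * y)
  split = solve-∀
  quadratic : 3 * (a * a) ≤ 2 * n * a + n * m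
  quadratic = begin
    3 * (a * a)                    ≤⟨ m≤m+n (3 * (a * a)) (3 * a) ⟩
    3 * (a * a) + 3 * a            ≡⟨ regroup a ⟩
    2 * suc a * a + suc a * a      ≤⟨ +-mono-≤ (*-monoˡ-≤ a (*-monoʳ-≤ 2 (s≤s a≤m))) (*-mono-≤ (s≤s a≤m) a≤m) ⟩
    2 * n * a + n * m              ∎
    where
    regroup : ∀ a → 3 * (a * a) + 3 * a ≡ 2 * suc a * a + suc a * a
    regroup = solve-∀

-- The discrete form of (1 − d/n)^n ≤ e^(−d), with 5/2 standing in for e.
5^d*c^n≤2^d*[c+d]^n : ∀ d c n → c + d ≤ n → 5 ^ d * c ^ n ≤ 2 ^ d * (c + d) ^ n
5^d*c^n≤2^d*[c+d]^n zero    c n _ = ≤-reflexive (cong (λ x → 1 * x ^ n) (sym (+-identityʳ c)))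
5^d*c^n≤2^d*[c+d]^n (suc d) c n c+d+1≤n = begin
  5 * 5 ^ d * c ^ n                   ≡⟨ xy∙z≈y∙xz 5 (5 ^ d) (c ^ n) ⟩
  5 ^ d * (5 * c ^ n)                 ≤⟨ *-monoʳ-≤ (5 ^ d) (5*a^n≤2*[1+a]^n c n (≤-trans (s≤s (m≤m+n c d)) c+1+d≤n)) ⟩
  5 ^ d * (2 * suc c ^ n)             ≡⟨ x∙yz≈y∙xz (5 ^ d) 2 _ ⟩
  2 * (5 ^ d * suc c ^ n)             ≤⟨ *-monoʳ-≤ 2 (5^d*c^n≤2^d*[c+d]^n d (suc c) n c+1+d≤n) ⟩
  2 * (2 ^ d * (suc c + d) ^ n)       ≡⟨ cong (λ x → 2 * (2 ^ d * x ^ n)) (+-suc c d) ⟨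
  2 * (2 ^ d * (c + suc d) ^ n)       ≡⟨ *-assoc 2 (2 ^ d) _ ⟨
  2 * 2 ^ d * (c + suc d) ^ n         ∎
  where
  c+1+d≤n : suc c + d ≤ n
  c+1+d≤n = ≤-trans (≤-reflexive (sym (+-suc c d))) c+d+1≤n

-- Raised to the powers 3 and 4: (27/8)^3 ≤ (5/2)^4 and A^4 ≤ B^3.
27^K≤B*8^K : ∀ A B K → A ^ 4 ≤ B ^ 3 → 5 ^ K ≤ A * 2 ^ K → 27 ^ K ≤ B * 8 ^ K
27^K≤B*8^K A B K A⁴≤B³ 5^K≤A*2^K = ^-cancelʳ-≤ 3 (*-cancelʳ-≤ _ _ (16 ^ K) {{m^n≢0 16 K}} (begin
  (27 ^ K) ^ 3 * 16 ^ K                  ≡⟨ cong (_* 16 ^ K) (^-swapʳ 27 K 3) ⟩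
  (27 ^ 3) ^ K * 16 ^ K                  ≡⟨ ^-distribʳ-* (27 ^ 3) 16 K ⟨
  (27 ^ 3 * 16) ^ K                      ≤⟨ ^-monoˡ-≤ K (from-yes (27 ^ 3 * 16 ≤? 5 ^ 4 * 8 ^ 3)) ⟩
  (5 ^ 4 * 8 ^ 3) ^ K                    ≡⟨ ^-distribʳ-* (5 ^ 4) (8 ^ 3) K ⟩
  (5 ^ 4) ^ K * (8 ^ 3) ^ K              ≡⟨ cong₂ _*_ (^-swapʳ 5 4 K) (^-swapʳ 8 3 K) ⟩
  (5 ^ K) ^ 4 * (8 ^ K) ^ 3              ≤⟨ *-monoˡ-≤ _ (^-monoˡ-≤ 4 5^K≤A*2^K) ⟩
  (A * 2 ^ K) ^ 4 * (8 ^ K) ^ 3          ≡⟨ cong (_* (8 ^ K) ^ 3) (^-distribʳ-* A (2 ^ K) 4) ⟩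
  A ^ 4 * (2 ^ K) ^ 4 * (8 ^ K) ^ 3      ≡⟨ cong (λ x → A ^ 4 * x * (8 ^ K) ^ 3) (^-swapʳ 2 K 4) ⟩
  A ^ 4 * 16 ^ K * (8 ^ K) ^ 3           ≡⟨ xy∙z≈xz∙y (A ^ 4) (16 ^ K) _ ⟩
  A ^ 4 * (8 ^ K) ^ 3 * 16 ^ K           ≤⟨ *-monoˡ-≤ _ (*-monoˡ-≤ _ A⁴≤B³) ⟩
  B ^ 3 * (8 ^ K) ^ 3 * 16 ^ K           ≡⟨ cong (_* 16 ^ K) (^-distribʳ-* B (8 ^ K) 3) ⟨
  (B * 8 ^ K) ^ 3 * 16 ^ K               ∎))

-- (c/n)^s is the probability that a random s-sample avoids d given vertices. If it exceeds
-- 1/((k+1) n²), then e^(ds/n) < (k+1) n² ≤ n^(9/4), whence e^(ds) ≤ n^(3n).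
frequentlyAvoided⇒ExpLe : ∀ k {n c d} s → c + d ≡ n → suc k ^ 4 ≤ n →
  n ^ s ≤ n * n * suc k * c ^ s → ExpLe (d * s) (n ^ (3 * n))
frequentlyAvoided⇒ExpLe k {n} {c} {d} s c+d≡n k⁴≤n likely =
  ExpLe-intro 2 (d * s) (n ^ (3 * n)) (27^K≤B*8^K (W ^ n) (n ^ (3 * n)) (d * s) Wⁿ⁴≤n³ⁿ³ 5^K≤Wⁿ*2^K)
  where
  instance
    n≢0 : NonZero n
    n≢0 = >-nonZero (≤-trans (m^n>0 (suc k) 4) k⁴≤n)
  W C N : ℕ
  W = n * n * suc k
  C = (c ^ s) ^ n
  N = (n ^ s) ^ n

  W⁴≤n⁹ : W ^ 4 ≤ n ^ 9
  W⁴≤n⁹ = begin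
    W ^ 4                      ≡⟨ ^-distribʳ-* (n * n) (suc k) 4 ⟩
    (n * n) ^ 4 * suc k ^ 4    ≤⟨ *-monoʳ-≤ ((n * n) ^ 4) k⁴≤n ⟩
    (n * n) ^ 4 * n            ≡⟨ collect n ⟩
    n ^ 9                      ∎
    where
    collect : ∀ n → (n * n) * ((n * n) * ((n * n) * ((n * n) * 1))) * n
                  ≡ n * (n * (n * (n * (n * (n * (n * (n * (n * 1))))))))
    collect = solve-∀

  Wⁿ⁴≤n³ⁿ³ : (W ^ n) ^ 4 ≤ (n ^ (3 * n)) ^ 3
  Wⁿ⁴≤n³ⁿ³ = begin
    (W ^ n) ^ 4          ≡⟨ ^-swapʳ W n 4 ⟩
    (W ^ 4) ^ n          ≤⟨ ^-monoˡ-≤ n W⁴≤n⁹ ⟩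
    (n ^ 9) ^ n          ≡⟨ ^-*-assoc n 9 n ⟩
    n ^ (9 * n)          ≡⟨ cong (n ^_) (*-comm 9 n) ⟩
    n ^ (n * 9)          ≡⟨ cong (n ^_) (*-assoc n 3 3) ⟨
    n ^ (n * 3 * 3)      ≡⟨ cong (λ e → n ^ (e * 3)) (*-comm n 3) ⟩
    n ^ (3 * n * 3)      ≡⟨ ^-*-assoc n (3 * n) 3 ⟨
    (n ^ (3 * n)) ^ 3    ∎

  shrink : (5 ^ d) ^ s * C ≤ (2 ^ d) ^ s * N
  shrink = begin
    (5 ^ d) ^ s * C              ≡⟨ cong ((5 ^ d) ^ s *_) (^-swapʳ c s n) ⟩
    (5 ^ d) ^ s * (c ^ n) ^ s    ≡⟨ ^-distribʳ-* (5 ^ d) (c ^ n) s ⟨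
    (5 ^ d * c ^ n) ^ s          ≤⟨ ^-monoˡ-≤ s dilute ⟩
    (2 ^ d * n ^ n) ^ s          ≡⟨ ^-distribʳ-* (2 ^ d) (n ^ n) s ⟩
    (2 ^ d) ^ s * (n ^ n) ^ s    ≡⟨ cong ((2 ^ d) ^ s *_) (^-swapʳ n n s) ⟩
    (2 ^ d) ^ s * N              ∎
    where
    dilute : 5 ^ d * c ^ n ≤ 2 ^ d * n ^ n
    dilute = subst (λ m → 5 ^ d * c ^ n ≤ 2 ^ d * m ^ n) c+d≡n
                   (5^d*c^n≤2^d*[c+d]^n d c n (≤-reflexive c+d≡n))

  N≤Wⁿ*C : N ≤ W ^ n * C
  N≤Wⁿ*C = begin
    (n ^ s) ^ n         ≤⟨ ^-monoˡ-≤ n likely ⟩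
    (W * c ^ s) ^ n     ≡⟨ ^-distribʳ-* W (c ^ s) n ⟩
    W ^ n * C           ∎

  5^K≤Wⁿ*2^K : 5 ^ (d * s) ≤ W ^ n * 2 ^ (d * s)
  5^K≤Wⁿ*2^K = subst₂ (λ x y → x ≤ W ^ n * y) (^-*-assoc 5 d s) (^-*-assoc 2 d s)
    (*-cancelʳ-≤ _ _ N {{m^n≢0 (n ^ s) n {{m^n≢0 n s}}}} (begin
      (5 ^ d) ^ s * N                   ≤⟨ *-monoʳ-≤ ((5 ^ d) ^ s) N≤Wⁿ*C ⟩
      (5 ^ d) ^ s * (W ^ n * C)         ≡⟨ x∙yz≈y∙xz ((5 ^ d) ^ s) (W ^ n) C ⟩
      W ^ n * ((5 ^ d) ^ s * C)         ≤⟨ *-monoʳ-≤ (W ^ n) shrink ⟩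
      W ^ n * ((2 ^ d) ^ s * N)         ≡⟨ *-assoc (W ^ n) _ N ⟨
      W ^ n * (2 ^ d) ^ s * N           ∎))

iverson : Bool → ℕ
iverson true  = 1
iverson false = 0

iverson-∧ : ∀ x y → iverson (x ∧ y) ≡ iverson x * iverson y
iverson-∧ true  y = sym (+-identityʳ (iverson y))
iverson-∧ false y = refl

iverson-not+iverson : ∀ x → iverson (not x) + iverson x ≡ 1
iverson-not+iverson true  = refl
iverson-not+iverson false = refl

∑ : ∀ {A : Set} → List A → (A → ℕ) → ℕ
∑ xs f = sum (map f xs)

∑-cong : ∀ {A : Set} (xs : List A) {f g : A → ℕ} → (∀ x → f x ≡ g x) → ∑ xs f ≡ ∑ xs g
∑-cong xs f≗g = cong sum (map-cong f≗g xs)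

∑-mono-≤ : ∀ {A : Set} (xs : List A) {f g : A → ℕ} → (∀ x → f x ≤ g x) → ∑ xs f ≤ ∑ xs g
∑-mono-≤ []       f≤g = z≤n
∑-mono-≤ (x ∷ xs) f≤g = +-mono-≤ (f≤g x) (∑-mono-≤ xs f≤g)

∑-distrib-+ : ∀ {A : Set} (xs : List A) (f g : A → ℕ) → ∑ xs (λ x → f x + g x) ≡ ∑ xs f + ∑ xs g
∑-distrib-+ []       f g = refl
∑-distrib-+ (x ∷ xs) f g = begin-equality
  f x + g x + ∑ xs (λ x → f x + g x)   ≡⟨ cong (f x + g x +_) (∑-distrib-+ xs f g) ⟩
  f x + g x + (∑ xs f + ∑ xs g)         ≡⟨ +-assoc (f x) (g x) _ ⟩
  f x + (g x + (∑ xs f + ∑ xs g))       ≡⟨ cong (f x +_) (x∙yz≈y∙xz⁺ (g x) (∑ xs f) (∑ xs g)) ⟩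
  f x + (∑ xs f + (g x + ∑ xs g))       ≡⟨ +-assoc (f x) (∑ xs f) _ ⟨
  f x + ∑ xs f + (g x + ∑ xs g)         ∎

∑-*ˡ : ∀ {A : Set} (xs : List A) c (f : A → ℕ) → ∑ xs (λ x → c * f x) ≡ c * ∑ xs f
∑-*ˡ []       c f = sym (*-zeroʳ c)
∑-*ˡ (x ∷ xs) c f = trans (cong (c * f x +_) (∑-*ˡ xs c f)) (sym (*-distribˡ-+ c (f x) (∑ xs f)))

∑-*ʳ : ∀ {A : Set} (xs : List A) c (f : A → ℕ) → ∑ xs (λ x → f x * c) ≡ ∑ xs f * c
∑-*ʳ xs c f = begin-equality
  ∑ xs (λ x → f x * c)   ≡⟨ ∑-cong xs (λ x → *-comm (f x) c) ⟩
  ∑ xs (λ x → c * f x)   ≡⟨ ∑-*ˡ xs c f ⟩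
  c * ∑ xs f             ≡⟨ *-comm c (∑ xs f) ⟩
  ∑ xs f * c             ∎

∑-const : ∀ {A : Set} (xs : List A) c → ∑ xs (λ _ → c) ≡ length xs * c
∑-const []       c = refl
∑-const (x ∷ xs) c = cong (c +_) (∑-const xs c)

∑-map : ∀ {A B : Set} (xs : List A) (g : A → B) (f : B → ℕ) → ∑ (map g xs) f ≡ ∑ xs (f ∘ g)
∑-map xs g f = cong sum (sym (map-∘ xs))

∑-concatMap : ∀ {A B : Set} (xs : List A) (g : A → List B) (f : B → ℕ) → ∑ (concatMap g xs) f ≡ ∑ xs (λ x → ∑ (g x) f)
∑-concatMap []       g f = refl
∑-concatMap (x ∷ xs) g f = begin-equality
  sum (map f (g x ++ concatMap g xs))     ≡⟨ cong sum (map-++ f (g x) (concatMap g xs)) ⟩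
  sum (map f (g x) ++ map f (concatMap g xs)) ≡⟨ sum-++ (map f (g x)) _ ⟩
  ∑ (g x) f + ∑ (concatMap g xs) f        ≡⟨ cong (∑ (g x) f +_) (∑-concatMap xs g f) ⟩
  ∑ (g x) f + ∑ xs (λ x → ∑ (g x) f)      ∎

∑-comm : ∀ {A B : Set} (xs : List A) (ys : List B) (f : A → B → ℕ) →
  ∑ xs (λ x → ∑ ys (f x)) ≡ ∑ ys (λ y → ∑ xs (λ x → f x y))
∑-comm []       ys f = sym (trans (∑-const ys 0) (*-zeroʳ (length ys)))
∑-comm (x ∷ xs) ys f = trans (cong (∑ ys (f x) +_) (∑-comm xs ys f)) (sym (∑-distrib-+ ys (f x) _))

length-filter≡∑ : ∀ {A : Set} (p : A → Bool) (xs : List A) → length (filter (λ x → p x Bool.≟ true) xs) ≡ ∑ xs (iverson ∘ p)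
length-filter≡∑ p []       = refl
length-filter≡∑ p (x ∷ xs) with p x
... | true  = cong suc (length-filter≡∑ p xs)
... | false = length-filter≡∑ p xs

countV≡∑ : ∀ {n} (p : Fin n → Bool) → countV p ≡ ∑ (allFin n) (iverson ∘ p)
countV≡∑ p = length-filter≡∑ p (allFin _)

countV-not+countV : ∀ {n} (p : Fin n → Bool) → countV (not ∘ p) + countV p ≡ n
countV-not+countV {n} p = begin-equality
  countV (not ∘ p) + countV p                       ≡⟨ cong₂ _+_ (countV≡∑ (not ∘ p)) (countV≡∑ p) ⟩
  ∑ (allFin n) (iverson ∘ not ∘ p) + ∑ (allFin n) (iverson ∘ p)
    ≡⟨ ∑-distrib-+ (allFin n) (iverson ∘ not ∘ p) (iverson ∘ p) ⟨
  ∑ (allFin n) (λ u → iverson (not (p u)) + iverson (p u)) ≡⟨ ∑-cong (allFin n) (iverson-not+iverson ∘ p) ⟩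
  ∑ (allFin n) (λ _ → 1)                            ≡⟨ ∑-const (allFin n) 1 ⟩
  length (allFin n) * 1                             ≡⟨ *-identityʳ _ ⟩
  length (allFin n)                                 ≡⟨ length-tabulate id ⟩
  n                                                 ∎

∑² : ∀ {n} → (Fin n → Fin n → ℕ) → ℕ
∑² {n} f = ∑ (allFin n) (λ a → ∑ (allFin n) (f a))

∑²-cong : ∀ {n} {f g : Fin n → Fin n → ℕ} → (∀ a b → f a b ≡ g a b) → ∑² f ≡ ∑² g
∑²-cong {n} f≗g = ∑-cong (allFin n) (λ a → ∑-cong (allFin n) (f≗g a))

∑²-mono-≤ : ∀ {n} {f g : Fin n → Fin n → ℕ} → (∀ a b → f a b ≤ g a b) → ∑² f ≤ ∑² g
∑²-mono-≤ {n} f≤g = ∑-mono-≤ (allFin n) (λ a → ∑-mono-≤ (allFin n) (f≤g a))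

∑²-distrib-+ : ∀ {n} (f g : Fin n → Fin n → ℕ) → ∑² (λ a b → f a b + g a b) ≡ ∑² f + ∑² g
∑²-distrib-+ {n} f g = trans (∑-cong (allFin n) (λ a → ∑-distrib-+ (allFin n) (f a) (g a)))
                             (∑-distrib-+ (allFin n) (λ a → ∑ (allFin n) (f a)) (λ a → ∑ (allFin n) (g a)))

∑²-*ˡ : ∀ {n} c (f : Fin n → Fin n → ℕ) → ∑² (λ a b → c * f a b) ≡ c * ∑² f
∑²-*ˡ {n} c f = trans (∑-cong (allFin n) (λ a → ∑-*ˡ (allFin n) c (f a)))
                      (∑-*ˡ (allFin n) c (λ a → ∑ (allFin n) (f a)))

∑²-const : ∀ {n} c → ∑² {n} (λ _ _ → c) ≡ n * (n * c)
∑²-const {n} c = begin-equality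
  ∑ (allFin n) (λ _ → ∑ (allFin n) (λ _ → c))   ≡⟨ ∑-cong (allFin n) (λ _ → ∑-const (allFin n) c) ⟩
  ∑ (allFin n) (λ _ → length (allFin n) * c)    ≡⟨ ∑-const (allFin n) _ ⟩
  length (allFin n) * (length (allFin n) * c)   ≡⟨ cong (λ m → m * (m * c)) (length-tabulate {n = n} id) ⟩
  n * (n * c)                                   ∎

_<ᶠ_ : ∀ {n} → Fin n → Fin n → Bool
a <ᶠ b = toℕ a <ᵇ toℕ b

countPairs≡∑² : ∀ {n} (p : Fin n → Fin n → Bool) → countPairs p ≡ ∑² (λ a b → iverson (a <ᶠ b ∧ p a b))
countPairs≡∑² {n} p = ∑-cong (allFin n) (λ a → countV≡∑ (λ b → a <ᶠ b ∧ p a b))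

or-false : ∀ {A : Set} (p : A → Bool) (xs : List A) → (∀ x → p x ≡ false) → or (map p xs) ≡ false
or-false p []       p≡false = refl
or-false p (x ∷ xs) p≡false rewrite p≡false x = or-false p xs p≡false

2≤δ : ∀ {n} (G : Graph n) {a b} → a ≢ b → adj G a b ≡ false → 2 ≤ δ G a b
2≤δ {suc zero}    G {zero} {zero} a≢b _ = contradiction refl a≢b
2≤δ {suc (suc m)} G {a}    {b}    a≢b a≁b = two-misses (λ k → reach G k a b) _ no-walk₀ no-walk₁
  where
  two-misses : ∀ (f : ℕ → Bool) xs → f 0 ≡ false → f 1 ≡ false →
    2 ≤ length (filter (λ k → not (f k) Bool.≟ true) (0 ∷ 1 ∷ xs))
  two-misses f xs f0≡false f1≡false rewrite f0≡false | f1≡false = s≤s (s≤s z≤n)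
  no-walk₀ : reach G 0 a b ≡ false
  no-walk₀ = trans (isYes≗does (a ≟ b)) (dec-false (a ≟ b) a≢b)
  no-edge-from-a : ∀ c → (reach G 0 a c ∧ adj G c b) ≡ false
  no-edge-from-a c with a ≟ c
  ... | yes refl = a≁b
  ... | no  _    = refl
  no-walk₁ : reach G 1 a b ≡ false
  no-walk₁ rewrite no-walk₀ = or-false _ (allFin _) no-edge-from-a

<ᶠ⇒≢ : ∀ {n} {a b : Fin n} → a <ᶠ b ≡ true → a ≢ b
<ᶠ⇒≢ {a = a} {b} a<b a≡b = <-irrefl (cong toℕ a≡b) (<ᵇ⇒< (toℕ a) (toℕ b) (Equivalence.from T-≡ a<b))

module _ {n : ℕ} (G : Graph n) where

  nonDistinguishing : Fin n → Fin n → ℕ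
  nonDistinguishing a b = countV (λ u → not (distinguishes G u a b))

  nonDistinguishing+Dsize : ∀ a b → nonDistinguishing a b + Dsize G a b ≡ n
  nonDistinguishing+Dsize a b = countV-not+countV (λ u → distinguishes G u a b)

  ∑-avoids : ∀ s a b → ∑ (allSamples n s) (λ S → iverson (avoids G S a b)) ≡ nonDistinguishing a b ^ s
  ∑-avoids zero    a b = refl
  ∑-avoids (suc s) a b = begin-equality
    ∑ (concatMap (λ u → map (u ∷_) (allSamples n s)) (allFin n)) avoid
      ≡⟨ ∑-concatMap (allFin n) _ avoid ⟩
    ∑ (allFin n) (λ u → ∑ (map (u ∷_) (allSamples n s)) avoid)
      ≡⟨ ∑-cong (allFin n) first-vertex ⟩
    ∑ (allFin n) (λ u → iverson (not (distinguishes G u a b)) * nonDistinguishing a b ^ s)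
      ≡⟨ ∑-*ʳ (allFin n) _ _ ⟩
    ∑ (allFin n) (λ u → iverson (not (distinguishes G u a b))) * nonDistinguishing a b ^ s
      ≡⟨ cong (_* nonDistinguishing a b ^ s) (countV≡∑ (λ u → not (distinguishes G u a b))) ⟨
    nonDistinguishing a b * nonDistinguishing a b ^ s
      ∎
    where
    avoid : Vec (Fin n) (suc s) → ℕ
    avoid S = iverson (avoids G S a b)
    first-vertex : ∀ u → ∑ (map (u ∷_) (allSamples n s)) avoid
                       ≡ iverson (not (distinguishes G u a b)) * nonDistinguishing a b ^ s
    first-vertex u = begin-equality
      ∑ (map (u ∷_) (allSamples n s)) avoid
        ≡⟨ ∑-map (allSamples n s) (u ∷_) avoid ⟩
      ∑ (allSamples n s) (λ S → iverson (not (distinguishes G u a b) ∧ avoids G S a b))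
        ≡⟨ ∑-cong (allSamples n s) (λ S → iverson-∧ _ (avoids G S a b)) ⟩
      ∑ (allSamples n s) (λ S → iverson (not (distinguishes G u a b)) * iverson (avoids G S a b))
        ≡⟨ ∑-*ˡ (allSamples n s) (iverson (not (distinguishes G u a b))) (λ S → iverson (avoids G S a b)) ⟩
      iverson (not (distinguishes G u a b)) * ∑ (allSamples n s) (λ S → iverson (avoids G S a b))
        ≡⟨ cong (iverson (not (distinguishes G u a b)) *_) (∑-avoids s a b) ⟩
      iverson (not (distinguishes G u a b)) * nonDistinguishing a b ^ s
        ∎

  totalHatEminusE≡∑² : ∀ s → totalHatEminusE G s
    ≡ ∑² (λ a b → iverson (a <ᶠ b ∧ not (adj G a b)) * nonDistinguishing a b ^ s)
  totalHatEminusE≡∑² s = begin-equality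
    ∑ samples (λ S → countPairs (λ a b → avoids G S a b ∧ not (adj G a b)))
      ≡⟨ ∑-cong samples (λ S → countPairs≡∑² (λ a b → avoids G S a b ∧ not (adj G a b))) ⟩
    ∑ samples (λ S → ∑² (λ a b → survives S a b))
      ≡⟨ ∑-comm samples (allFin n) _ ⟩
    ∑ (allFin n) (λ a → ∑ samples (λ S → ∑ (allFin n) (survives S a)))
      ≡⟨ ∑-cong (allFin n) (λ a → ∑-comm samples (allFin n) _) ⟩
    ∑² (λ a b → ∑ samples (λ S → survives S a b))
      ≡⟨ ∑²-cong pair ⟩
    ∑² (λ a b → iverson (a <ᶠ b ∧ not (adj G a b)) * nonDistinguishing a b ^ s)
      ∎
    where
    samples : List (Vec (Fin n) s)
    samples = allSamples n s
    survives : Vec (Fin n) s → Fin n → Fin n → ℕ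
    survives S a b = iverson (a <ᶠ b ∧ (avoids G S a b ∧ not (adj G a b)))
    pair : ∀ a b → ∑ samples (λ S → survives S a b)
                 ≡ iverson (a <ᶠ b ∧ not (adj G a b)) * nonDistinguishing a b ^ s
    pair a b = begin-equality
      ∑ samples (λ S → survives S a b)
        ≡⟨ ∑-cong samples (λ S → split (a <ᶠ b) (avoids G S a b) (not (adj G a b))) ⟩
      ∑ samples (λ S → iverson (a <ᶠ b ∧ not (adj G a b)) * iverson (avoids G S a b))
        ≡⟨ ∑-*ˡ samples (iverson (a <ᶠ b ∧ not (adj G a b))) (λ S → iverson (avoids G S a b)) ⟩
      iverson (a <ᶠ b ∧ not (adj G a b)) * ∑ samples (λ S → iverson (avoids G S a b))
        ≡⟨ cong (iverson (a <ᶠ b ∧ not (adj G a b)) *_) (∑-avoids s a b) ⟩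
      iverson (a <ᶠ b ∧ not (adj G a b)) * nonDistinguishing a b ^ s
        ∎
      where
      split : ∀ x y z → iverson (x ∧ (y ∧ z)) ≡ iverson (x ∧ z) * iverson y
      split x y z = begin-equality
        iverson (x ∧ (y ∧ z))               ≡⟨ trans (iverson-∧ x (y ∧ z)) (cong (iverson x *_) (iverson-∧ y z)) ⟩
        iverson x * (iverson y * iverson z) ≡⟨ x∙yz≈xz∙y (iverson x) (iverson y) (iverson z) ⟩
        iverson x * iverson z * iverson y   ≡⟨ cong (_* iverson y) (iverson-∧ x z) ⟨
        iverson (x ∧ z) * iverson y         ∎

module _ (k s : ℕ) {n : ℕ} (k⁴≤n : suc k ^ 4 ≤ n) (G : Graph n)
         {χB : Fin n → Fin n → Bool} (isχB : IsCharB G s χB) where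

  rarelyAvoided : ∀ {a b} → a ≢ b → adj G a b ≡ false → ¬ InB G s a b →
    n * n * suc k * nonDistinguishing G a b ^ s ≤ n ^ s
  rarelyAvoided {a} {b} a≢b a≁b ∉B with n * n * suc k * nonDistinguishing G a b ^ s ≤? n ^ s
  ... | yes rare = rare
  ... | no  ≰    = contradiction
    (2≤δ G a≢b a≁b , frequentlyAvoided⇒ExpLe k s (nonDistinguishing+Dsize G a b) k⁴≤n (<⇒≤ (≰⇒> ≰))) ∉B

  pair-≤ : ∀ a b →
    n * n * suc k * (iverson (a <ᶠ b ∧ not (adj G a b)) * nonDistinguishing G a b ^ s)
      ≤ n * n * suc k * (n ^ s * iverson (a <ᶠ b ∧ χB a b)) + n ^ s
  pair-≤ a b with a <ᶠ b in a<b | adj G a b in a≁b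
  ... | false | _     = ≤-trans (≤-reflexive (*-zeroʳ (n * n * suc k))) z≤n
  ... | true  | true  = ≤-trans (≤-reflexive (*-zeroʳ (n * n * suc k))) z≤n
  ... | true  | false with χB a b in χ
  ...   | true  = ≤-trans (*-monoʳ-≤ (n * n * suc k) avoided≤all) (m≤m+n _ (n ^ s))
    where
    avoided≤all : 1 * nonDistinguishing G a b ^ s ≤ n ^ s * 1
    avoided≤all = begin
      1 * nonDistinguishing G a b ^ s    ≡⟨ *-identityˡ _ ⟩
      nonDistinguishing G a b ^ s        ≤⟨ ^-monoˡ-≤ s (m≤m+n _ (Dsize G a b)) ⟩
      (nonDistinguishing G a b + Dsize G a b) ^ s ≡⟨ cong (_^ s) (nonDistinguishing+Dsize G a b) ⟩
      n ^ s                              ≡⟨ *-identityʳ (n ^ s) ⟨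
      n ^ s * 1                          ∎
  ...   | false = ≤-trans rare (m≤n+m (n ^ s) _)
    where
    ∉B : ¬ InB G s a b
    ∉B inB with () ← trans (sym (proj₂ (isχB a b) inB)) χ
    rare : n * n * suc k * (1 * nonDistinguishing G a b ^ s) ≤ n ^ s
    rare = subst (_≤ n ^ s) (cong (n * n * suc k *_) (sym (*-identityˡ _)))
                 (rarelyAvoided (<ᶠ⇒≢ a<b) a≁b ∉B)

  totalHatEminusE-≤ : suc k * totalHatEminusE G s ≤ n ^ s * (suc k * countPairs χB + 1)
  totalHatEminusE-≤ = *-cancelˡ-≤ (n * n) {{m*n≢0 n n}} (begin
    n * n * (suc k * totalHatEminusE G s)            ≡⟨ *-assoc (n * n) (suc k) _ ⟨
    W * totalHatEminusE G s                          ≡⟨ cong (W *_) (totalHatEminusE≡∑² G s) ⟩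
    W * ∑² survivors                                 ≡⟨ ∑²-*ˡ W survivors ⟨
    ∑² (λ a b → W * survivors a b)                   ≤⟨ ∑²-mono-≤ pair-≤ ⟩
    ∑² (λ a b → W * (n ^ s * inB a b) + n ^ s)       ≡⟨ ∑²-distrib-+ (λ a b → W * (n ^ s * inB a b)) (λ _ _ → n ^ s) ⟩
    ∑² (λ a b → W * (n ^ s * inB a b)) + ∑² {n} (λ _ _ → n ^ s)
      ≡⟨ cong₂ _+_ (trans (∑²-*ˡ W (λ a b → n ^ s * inB a b)) (cong (W *_) (∑²-*ˡ (n ^ s) inB)))
                   (∑²-const {n} (n ^ s)) ⟩
    W * (n ^ s * ∑² inB) + n * (n * n ^ s)           ≡⟨ cong (λ x → W * (n ^ s * x) + n * (n * n ^ s)) (countPairs≡∑² χB) ⟨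
    W * (n ^ s * countPairs χB) + n * (n * n ^ s)    ≡⟨ regroup n (suc k) (n ^ s) (countPairs χB) ⟩
    n * n * (n ^ s * (suc k * countPairs χB + 1))    ∎)
    where
    instance
      n≢0 : NonZero n
      n≢0 = >-nonZero (≤-trans (m^n>0 (suc k) 4) k⁴≤n)
    W : ℕ
    W = n * n * suc k
    survivors : Fin n → Fin n → ℕ
    survivors a b = iverson (a <ᶠ b ∧ not (adj G a b)) * nonDistinguishing G a b ^ s
    inB : Fin n → Fin n → ℕ
    inB a b = iverson (a <ᶠ b ∧ χB a b)
    regroup : ∀ n K x c → n * n * K * (x * c) + n * (n * x) ≡ n * n * (x * (K * c + 1))
    regroup = solve-∀

lemma10 : (s : ℕ → ℕ) → OmegaLog s →
            ∀ (k : ℕ) → ∃ λ N → ∀ n → N ≤ n →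
            ∀ (G : Graph n) → Connected G →
            ∀ (χB : Fin n → Fin n → Bool) → IsCharB G (s n) χB →
            suc k * totalHatEminusE G (s n) ≤ n ^ s n * (suc k * countPairs χB + 1)
lemma10 s _ k = suc k ^ 4 , λ n k⁴≤n G _ χB isχB → totalHatEminusE-≤ k (s n) k⁴≤n G isχB
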